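{- Let $\mathfrak{H}=\mathbb{Q}\langle x,y\rangle$, $z_j=x^{j-1}y$ for $j\geq 1$, and let $S:\mathfrak{H}\to\mathfrak{H}$ be the $\mathbb{Q}$-linear map defined below. For all integers $k,n\geq 1$, $$S(z_{k+1}z_1^n)=\sum_{t=1}^{n+1}\ \sum_{\substack{a_1+a_2+\dots+a_t=n+1-t\\ a_i\geq 0,\ i=1,\dots,t}} z_{a_t+k+1}\,z_{a_1+1}\,z_{a_2+1}\cdots z_{a_{t-1}+1}.$$
   Context: $\mathfrak{H}=\mathbb{Q}\langle x,y\rangle$ is the noncommutative polynomial algebra over $\mathbb{Q}$ in two letters $x,y$; words in $x,y$ (including the empty word $1$) form a $\mathbb{Q}$-basis. For a positive integer $j$, $z_j=x^{j-1}y$. Let $\sigma$ be the algebra automorphism of $\mathfrak{H}$ with $\sigma(x)=x$, $\sigma(y)=x+y$. Define the $\mathbb{Q}$-linear map $S:\mathfrak{H}\to\mathfrak{H}$ by $S(1)=1$ and $S(wa)=\sigma(w)a$ for every word $w$ and every letter $a\in\{x,y\}$. For $t=1$ the product $z_{a_1+1}\cdots z_{a_{t-1}+1}$ is empty (equal to $1$). -}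

module Defs where

open import Data.Nat using (ℕ; zero; suc; _+_; _∸_)
import Data.Nat as N
open import Data.Rational using (ℚ; 0ℚ; 1ℚ) renaming (_+_ to _+ℚ_; _*_ to _*ℚ_)
open import Data.List using (List; []; _∷_; _++_; map; concatMap; concat; replicate; applyUpTo; foldr; unsnoc; upTo)
open import Data.Product using (_×_; _,_)
open import Data.Maybe using (just; nothing)
open import Relation.Nullary using (yes; no; Dec)
open import Relation.Binary.PropositionalEquality using (_≡_; refl)
import Data.List.Properties as LP

data Letter : Set where
  x y : Letter

_≟L_ : (a b : Letter) → Dec (a ≡ b)
x ≟L x = yes refl
x ≟L y = no (λ ())
y ≟L x = no (λ ())
y ≟L y = yes refl

Word : Set
Word = List Letter

_≟W_ : (u v : Word) → Dec (u ≡ v)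
_≟W_ = LP.≡-dec _≟L_

-- Elements of 𝔥 = ℚ⟨x,y⟩, represented as finite formal ℚ-linear
-- combinations of words (list of coefficient/word pairs).
Poly : Set
Poly = List (ℚ × Word)

coeff : Poly → Word → ℚ
coeff [] w = 0ℚ
coeff ((c , u) ∷ p) w with u ≟W w
... | yes _ = c +ℚ coeff p w
... | no  _ = coeff p w

_≈P_ : Poly → Poly → Set
p ≈P q = ∀ w → coeff p w ≡ coeff q w

infix 4 _≈P_

word : Word → Poly
word w = (1ℚ , w) ∷ []

one : Poly
one = word []

_+P_ : Poly → Poly → Poly
_+P_ = _++_

scale : ℚ → Poly → Poly
scale c = map (λ { (d , w) → (c *ℚ d , w) })

_*P_ : Poly → Poly → Poly
p *P q = concatMap (λ { (a , u) → map (λ { (b , v) → (a *ℚ b , u ++ v) }) q }) p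

σL : Letter → Poly
σL x = word (x ∷ [])
σL y = word (x ∷ []) +P word (y ∷ [])

σW : Word → Poly
σW = foldr (λ a acc → σL a *P acc) one

σ : Poly → Poly
σ = concatMap (λ { (c , w) → scale c (σW w) })

SW : Word → Poly
SW w with unsnoc w
... | nothing      = one
... | just (u , a) = σW u *P word (a ∷ [])

S : Poly → Poly
S = concatMap (λ { (c , w) → scale c (SW w) })

-- z_j = x^{j-1} y  (used only for j ≥ 1)
z : ℕ → Word
z j = replicate (j ∸ 1) x ++ (y ∷ [])

z1^ : ℕ → Word
z1^ n = concat (replicate n (z 1))

comps : ℕ → ℕ → List (List ℕ)
comps zero zero = [] ∷ []
comps zero (suc m) = []
comps (suc t) m = concatMap (λ a → map (a ∷_) (comps t (m ∸ a))) (applyUpTo (λ i → i) (suc m))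

term : ℕ → List ℕ → Poly
term k as with unsnoc as
... | nothing         = []
... | just (ini , at) = word (z (at + k + 1) ++ concatMap (λ a → z (a + 1)) ini)

RHS : ℕ → ℕ → Poly
RHS k n = concatMap (λ t → concatMap (term k) (comps t (n + 1 ∸ t))) (applyUpTo suc (n + 1))

-- S(z_{k+1} z_1^n) = S(x^k y^(n+1)) = σ(x^k y^n) y = x^k (x + y)^n y, the sum of the
-- words x^k u y over all words u of length n, each with coefficient 1. Cutting u y
-- after every y writes it uniquely as z_{c_1} ⋯ z_{c_t} with c_1 + ⋯ + c_t = n + 1;
-- absorbing x^k into the first factor and putting a_t = c_1 - 1, a_i = c_{i+1} - 1
-- gives exactly the summands on the right, each once. Two sums of distinct words
-- with coefficient 1 are equal as soon as they have the same words.
module Submission where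

open import Defs
open import Data.Nat using (ℕ; zero; suc; _+_; _∸_; _≤_; s≤s)
open import Data.Nat.Properties
  using (+-comm; +-assoc; +-suc; +-cancelʳ-≡; m+n∸m≡n; m+n∸n≡m; m∸n+n≡m; m+[n∸m]≡n; ≤-pred; m≤m+n; m≤n+m; <⇒≢; suc-injective)
open import Data.Nat.ListAction using (sum)
open import Data.Nat.ListAction.Properties using (sum-↭)
open import Data.List
  using (List; []; _∷_; [_]; _++_; _∷ʳ_; map; concatMap; replicate; applyUpTo; unsnoc; initLast; _∷ʳ′_; length)
open import Data.List.Properties
  using (++-assoc; ++-identityʳ; ++-cancelˡ; ∷-injectiveʳ; ∷ʳ-injectiveˡ; length-++; length-replicate;
         map-++; map-∘; map-id; map-cong; map-concatMap; concatMap-cong; concatMap-++)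
open import Data.List.Membership.Propositional using (_∈_; _∉_; find)
open import Data.List.Membership.Propositional.Properties
  using (∈-map⁺; ∈-map⁻; ∈-++⁺ˡ; ∈-++⁺ʳ; ∈-++⁻; ∈-concat⁺′; ∈-concatMap⁻; ∈-applyUpTo⁺; ∈-applyUpTo⁻)
open import Data.List.Membership.DecPropositional _≟W_ using (_∈?_)
open import Data.List.Relation.Binary.Subset.Propositional using (_⊆_)
open import Data.List.Relation.Binary.Permutation.Propositional.Properties using (∷↭∷ʳ; ↭-length)
open import Data.List.Relation.Unary.Any using (here; there)
open import Data.List.Relation.Unary.All using ([])
open import Data.List.Relation.Unary.AllPairs using ([]; _∷_)
open import Data.List.Relation.Unary.Unique.Propositional using (Unique)
import Data.List.Relation.Unary.Unique.Propositional.Properties as Unique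
open import Data.Product using (_×_; _,_; proj₁; map₁; ∃; ∃₂)
open import Data.Sum using (inj₁; inj₂)
open import Data.Empty using (⊥; ⊥-elim)
open import Data.Maybe using (just; nothing)
open import Data.Rational using (0ℚ; 1ℚ) renaming (_+_ to _+ℚ_)
open import Data.Rational.Properties using (*-identityˡ; +-identityʳ)
open import Function using (_∘_)
open import Relation.Nullary using (yes; no)
open import Relation.Binary.PropositionalEquality using (_≡_; refl; sym; trans; cong; cong₂; subst; subst₂; module ≡-Reasoning)
open ≡-Reasoning

module _ {A : Set} where

  replicate-+ : ∀ m n (a : A) → replicate (m + n) a ≡ replicate m a ++ replicate n a
  replicate-+ zero    n a = refl
  replicate-+ (suc m) n a = cong (a ∷_) (replicate-+ m n a)

  ∷-replicate : ∀ n (a : A) → a ∷ replicate n a ≡ replicate n a ∷ʳ a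
  ∷-replicate zero    a = refl
  ∷-replicate (suc n) a = cong (a ∷_) (∷-replicate n a)

  initLast-∷ʳ : ∀ (xs : List A) a → initLast (xs ∷ʳ a) ≡ xs ∷ʳ′ a
  initLast-∷ʳ []       a = refl
  initLast-∷ʳ (b ∷ xs) a rewrite initLast-∷ʳ xs a = refl

  unsnoc-∷ʳ : ∀ (xs : List A) a → unsnoc (xs ∷ʳ a) ≡ just (xs , a)
  unsnoc-∷ʳ xs a rewrite initLast-∷ʳ xs a = refl

module _ {A B : Set} {f : A → List B} where

  Unique-concatMap : ∀ {xs} → Unique xs → (∀ a → Unique (f a)) →
                     (∀ {a b w} → w ∈ f a → w ∈ f b → a ≡ b) → Unique (concatMap f xs)
  Unique-concatMap {[]}     _          _       _   = []
  Unique-concatMap {a ∷ xs} a∷xs!@(_ ∷ xs!) f-unique f-inj =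
    Unique.++⁺ (f-unique a) (Unique-concatMap xs! f-unique f-inj) disjoint
    where
    disjoint : ∀ {w} → w ∈ f a × w ∈ concatMap f xs → ⊥
    disjoint (w∈fa , w∈rest) with find (∈-concatMap⁻ f w∈rest)
    ... | b , b∈xs , w∈fb with f-inj w∈fa w∈fb
    ... | refl = Unique.Unique[x∷xs]⇒x∉xs a∷xs! b∈xs

fromWords : List Word → Poly
fromWords = map (1ℚ ,_)

coeff-fromWords-∉ : ∀ {ws w} → w ∉ ws → coeff (fromWords ws) w ≡ 0ℚ
coeff-fromWords-∉ {[]}     _  = refl
coeff-fromWords-∉ {u ∷ ws} {w} w∉ with u ≟W w
... | yes refl = ⊥-elim (w∉ (here refl))
... | no  _    = coeff-fromWords-∉ (w∉ ∘ there)

coeff-fromWords-∈ : ∀ {ws w} → Unique ws → w ∈ ws → coeff (fromWords ws) w ≡ 1ℚ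
coeff-fromWords-∈ {u ∷ ws} {w} u∷ws!@(_ ∷ ws!) w∈ with u ≟W w | w∈
... | yes refl | _         = trans (cong (1ℚ +ℚ_) (coeff-fromWords-∉ (Unique.Unique[x∷xs]⇒x∉xs u∷ws!)))
                                   (+-identityʳ 1ℚ)
... | no  u≢w  | here w≡u  = ⊥-elim (u≢w (sym w≡u))
... | no  _    | there w∈′ = coeff-fromWords-∈ ws! w∈′

fromWords-≈P : ∀ {us vs} → Unique us → Unique vs → us ⊆ vs → vs ⊆ us → fromWords us ≈P fromWords vs
fromWords-≈P {us} us! vs! us⊆vs vs⊆us w with w ∈? us
... | yes w∈us = trans (coeff-fromWords-∈ us! w∈us) (sym (coeff-fromWords-∈ vs! (us⊆vs w∈us)))
... | no  w∉us = trans (coeff-fromWords-∉ w∉us) (sym (coeff-fromWords-∉ (w∉us ∘ vs⊆us)))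

concatMap-fromWords : ∀ {A : Set} (f : A → List Word) xs →
                      concatMap (fromWords ∘ f) xs ≡ fromWords (concatMap f xs)
concatMap-fromWords f xs = sym (map-concatMap (1ℚ ,_) f xs)

word-*P : ∀ u vs → word u *P fromWords vs ≡ fromWords (map (u ++_) vs)
word-*P u []       = refl
word-*P u (v ∷ vs) = cong ((1ℚ , u ++ v) ∷_) (word-*P u vs)

fromWords-*P-word : ∀ us v → fromWords us *P word v ≡ fromWords (map (_++ v) us)
fromWords-*P-word []       v = refl
fromWords-*P-word (u ∷ us) v = cong ((1ℚ , u ++ v) ∷_) (fromWords-*P-word us v)

++-*P : ∀ p p′ q → (p ++ p′) *P q ≡ p *P q ++ p′ *P q
++-*P p p′ q = concatMap-++ _ p p′

scale-identity : ∀ p → scale 1ℚ p ≡ p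
scale-identity []            = refl
scale-identity ((c , w) ∷ p) = cong₂ _∷_ (cong (_, w) (*-identityˡ c)) (scale-identity p)

S-word : ∀ w → S (word w) ≡ SW w
S-word w = trans (++-identityʳ _) (scale-identity (SW w))

SW-∷ʳ : ∀ v a → SW (v ∷ʳ a) ≡ σW v *P word [ a ]
SW-∷ʳ v a rewrite unsnoc-∷ʳ v a = refl

σWords : Word → List Word
σWords []      = [ [] ]
σWords (x ∷ w) = map (x ∷_) (σWords w)
σWords (y ∷ w) = map (x ∷_) (σWords w) ++ map (y ∷_) (σWords w)

σW-fromWords : ∀ w → σW w ≡ fromWords (σWords w)
σW-fromWords []      = refl
σW-fromWords (x ∷ w) = trans (cong (word [ x ] *P_) (σW-fromWords w)) (word-*P [ x ] (σWords w))
σW-fromWords (y ∷ w) = begin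
  (word [ x ] ++ word [ y ]) *P σW w                         ≡⟨ ++-*P (word [ x ]) (word [ y ]) (σW w) ⟩
  word [ x ] *P σW w ++ word [ y ] *P σW w                   ≡⟨ cong (λ p → word [ x ] *P p ++ word [ y ] *P p) (σW-fromWords w) ⟩
  word [ x ] *P fromWords ws ++ word [ y ] *P fromWords ws   ≡⟨ cong₂ _++_ (word-*P [ x ] ws) (word-*P [ y ] ws) ⟩
  fromWords (map (x ∷_) ws) ++ fromWords (map (y ∷_) ws)     ≡⟨ map-++ (1ℚ ,_) (map (x ∷_) ws) _ ⟨
  fromWords (σWords (y ∷ w))                                 ∎
  where ws = σWords w

σWords-unique : ∀ w → Unique (σWords w)
σWords-unique []      = [] ∷ []
σWords-unique (x ∷ w) = Unique.map⁺ ∷-injectiveʳ (σWords-unique w)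
σWords-unique (y ∷ w) = Unique.++⁺ (Unique.map⁺ ∷-injectiveʳ (σWords-unique w))
                                   (Unique.map⁺ ∷-injectiveʳ (σWords-unique w)) disjoint
  where
  disjoint : ∀ {v} → v ∈ map (x ∷_) (σWords w) × v ∈ map (y ∷_) (σWords w) → ⊥
  disjoint (v∈x , v∈y) with ∈-map⁻ (x ∷_) v∈x | ∈-map⁻ (y ∷_) v∈y
  ... | _ , _ , refl | _ , _ , ()

σWords-replicate-x : ∀ k w → σWords (replicate k x ++ w) ≡ map (replicate k x ++_) (σWords w)
σWords-replicate-x zero    w = sym (map-id (σWords w))
σWords-replicate-x (suc k) w = trans (cong (map (x ∷_)) (σWords-replicate-x k w)) (sym (map-∘ (σWords w)))

∈-σWords-replicate-y⁻ : ∀ n {v} → v ∈ σWords (replicate n y) → length v ≡ n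
∈-σWords-replicate-y⁻ zero    (here refl) = refl
∈-σWords-replicate-y⁻ (suc n) v∈ with ∈-++⁻ (map (x ∷_) (σWords (replicate n y))) v∈
... | inj₁ v∈x with ∈-map⁻ (x ∷_) v∈x
...   | _ , v′∈ , refl = cong suc (∈-σWords-replicate-y⁻ n v′∈)
∈-σWords-replicate-y⁻ (suc n) v∈ | inj₂ v∈y with ∈-map⁻ (y ∷_) v∈y
...   | _ , v′∈ , refl = cong suc (∈-σWords-replicate-y⁻ n v′∈)

∈-σWords-replicate-y⁺ : ∀ v → v ∈ σWords (replicate (length v) y)
∈-σWords-replicate-y⁺ []      = here refl
∈-σWords-replicate-y⁺ (x ∷ v) = ∈-++⁺ˡ (∈-map⁺ (x ∷_) (∈-σWords-replicate-y⁺ v))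
∈-σWords-replicate-y⁺ (y ∷ v) = ∈-++⁺ʳ _ (∈-map⁺ (y ∷_) (∈-σWords-replicate-y⁺ v))

z1^-replicate : ∀ n → z1^ n ≡ replicate n y
z1^-replicate zero    = refl
z1^-replicate (suc n) = cong (y ∷_) (z1^-replicate n)

z-z1^ : ∀ k n → z (k + 1) ++ z1^ n ≡ (replicate k x ++ replicate n y) ∷ʳ y
z-z1^ k n = begin
  z (k + 1) ++ z1^ n                         ≡⟨ cong₂ _++_ (cong z (+-comm k 1)) (z1^-replicate n) ⟩
  (replicate k x ++ [ y ]) ++ replicate n y  ≡⟨ ++-assoc (replicate k x) [ y ] (replicate n y) ⟩
  replicate k x ++ y ∷ replicate n y         ≡⟨ cong (replicate k x ++_) (∷-replicate n y) ⟩
  replicate k x ++ (replicate n y ∷ʳ y)      ≡⟨ ++-assoc (replicate k x) (replicate n y) [ y ] ⟨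
  (replicate k x ++ replicate n y) ∷ʳ y      ∎

lhsWords : ℕ → ℕ → List Word
lhsWords k n = map (λ u → replicate k x ++ (u ∷ʳ y)) (σWords (replicate n y))

S-lhs : ∀ k n → S (word (z (k + 1) ++ z1^ n)) ≡ fromWords (lhsWords k n)
S-lhs k n = begin
  S (word (z (k + 1) ++ z1^ n))                        ≡⟨ cong (S ∘ word) (z-z1^ k n) ⟩
  S (word (v ∷ʳ y))                                    ≡⟨ S-word (v ∷ʳ y) ⟩
  SW (v ∷ʳ y)                                          ≡⟨ SW-∷ʳ v y ⟩
  σW v *P word [ y ]                                   ≡⟨ cong (_*P word [ y ]) (σW-fromWords v) ⟩
  fromWords (σWords v) *P word [ y ]                   ≡⟨ fromWords-*P-word (σWords v) [ y ] ⟩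
  fromWords (map (_∷ʳ y) (σWords v))                   ≡⟨ cong (fromWords ∘ map (_∷ʳ y)) (σWords-replicate-x k _) ⟩
  fromWords (map (_∷ʳ y) (map (replicate k x ++_) us)) ≡⟨ cong fromWords (map-∘ us) ⟨
  fromWords (map (λ u → (replicate k x ++ u) ∷ʳ y) us) ≡⟨ cong fromWords (map-cong (λ u → ++-assoc (replicate k x) u [ y ]) us) ⟩
  fromWords (lhsWords k n)                             ∎
  where
  v  = replicate k x ++ replicate n y
  us = σWords (replicate n y)

lhsWords-unique : ∀ k n → Unique (lhsWords k n)
lhsWords-unique k n = Unique.map⁺ (λ {u} {u′} e → ∷ʳ-injectiveˡ u u′ (++-cancelˡ (replicate k x) _ _ e))
                                  (σWords-unique (replicate n y))

blocks : List ℕ → Word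
blocks []       = []
blocks (a ∷ as) = replicate a x ++ y ∷ blocks as

concatMap-z-blocks : ∀ as → concatMap (λ a → z (a + 1)) as ≡ blocks as
concatMap-z-blocks []       = refl
concatMap-z-blocks (a ∷ as) = begin
  z (a + 1) ++ concatMap (λ a → z (a + 1)) as  ≡⟨ cong₂ _++_ (cong z (+-comm a 1)) (concatMap-z-blocks as) ⟩
  (replicate a x ++ [ y ]) ++ blocks as        ≡⟨ ++-assoc (replicate a x) [ y ] (blocks as) ⟩
  blocks (a ∷ as)                              ∎

blocks-+ : ∀ a k as → blocks ((a + k) ∷ as) ≡ replicate k x ++ blocks (a ∷ as)
blocks-+ a k as = begin
  replicate (a + k) x ++ r                ≡⟨ cong (λ m → replicate m x ++ r) (+-comm a k) ⟩
  replicate (k + a) x ++ r                ≡⟨ cong (_++ r) (replicate-+ k a x) ⟩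
  (replicate k x ++ replicate a x) ++ r   ≡⟨ ++-assoc (replicate k x) (replicate a x) r ⟩
  replicate k x ++ blocks (a ∷ as)        ∎
  where r = y ∷ blocks as

x^-y-injective : ∀ a b {r s} → replicate a x ++ y ∷ r ≡ replicate b x ++ y ∷ s → a ≡ b × r ≡ s
x^-y-injective zero    zero    e = refl , ∷-injectiveʳ e
x^-y-injective (suc a) (suc b) e = map₁ (cong suc) (x^-y-injective a b (∷-injectiveʳ e))

blocks-injective : ∀ {as bs} → blocks as ≡ blocks bs → as ≡ bs
blocks-injective {[]}        {[]}        _ = refl
blocks-injective {[]}        {zero  ∷ _} ()
blocks-injective {[]}        {suc _ ∷ _} ()
blocks-injective {zero  ∷ _} {[]}        ()
blocks-injective {suc _ ∷ _} {[]}        ()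
blocks-injective {a ∷ as}    {b ∷ bs}    e with x^-y-injective a b e
... | refl , e′ = cong (a ∷_) (blocks-injective e′)

length-blocks : ∀ as → length (blocks as) ≡ sum as + length as
length-blocks []       = refl
length-blocks (a ∷ as) = begin
  length (replicate a x ++ y ∷ blocks as)            ≡⟨ length-++ (replicate a x) ⟩
  length (replicate a x) + suc (length (blocks as))  ≡⟨ cong₂ (λ m l → m + suc l) (length-replicate a) (length-blocks as) ⟩
  a + suc (sum as + length as)                       ≡⟨ cong (a +_) (+-suc (sum as) (length as)) ⟨
  a + (sum as + suc (length as))                     ≡⟨ +-assoc a (sum as) (suc (length as)) ⟨
  sum (a ∷ as) + length (a ∷ as)                     ∎

length-blocks-rotate : ∀ a as → length (blocks (a ∷ as)) ≡ sum (as ∷ʳ a) + length (as ∷ʳ a)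
length-blocks-rotate a as =
  trans (length-blocks (a ∷ as)) (cong₂ _+_ (sum-↭ (∷↭∷ʳ a as)) (↭-length (∷↭∷ʳ a as)))

∷ʳy-blocks : ∀ u → ∃₂ λ b bs → u ∷ʳ y ≡ blocks (b ∷ bs)
∷ʳy-blocks []      = 0 , [] , refl
∷ʳy-blocks (x ∷ u) with ∷ʳy-blocks u
... | b , bs , e = suc b , bs , cong (x ∷_) e
∷ʳy-blocks (y ∷ u) with ∷ʳy-blocks u
... | b , bs , e = 0 , b ∷ bs , cong (y ∷_) e

blocks-∷ʳy : ∀ b bs → ∃ λ u → blocks (b ∷ bs) ≡ u ∷ʳ y
blocks-∷ʳy b []       = replicate b x , refl
blocks-∷ʳy b (c ∷ cs) with blocks-∷ʳy c cs
... | u , e = replicate b x ++ y ∷ u ,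
              trans (cong (λ r → replicate b x ++ y ∷ r) e) (sym (++-assoc (replicate b x) (y ∷ u) [ y ]))

∈-comps⁻ : ∀ t m {as} → as ∈ comps t m → length as ≡ t × sum as ≡ m
∈-comps⁻ zero    zero    (here refl) = refl , refl
∈-comps⁻ (suc t) m       as∈ with find (∈-concatMap⁻ (λ a → map (a ∷_) (comps t (m ∸ a))) {xs = applyUpTo (λ i → i) (suc m)} as∈)
... | a , a∈ , as∈′ with ∈-applyUpTo⁻ (λ i → i) a∈ | ∈-map⁻ (a ∷_) as∈′
...   | _ , a<1+m , refl | bs , bs∈ , refl with ∈-comps⁻ t (m ∸ a) bs∈
...     | refl , sum≡ = refl , trans (cong (a +_) sum≡) (m+[n∸m]≡n (≤-pred a<1+m))

∈-comps⁺ : ∀ as → as ∈ comps (length as) (sum as)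
∈-comps⁺ []       = here refl
∈-comps⁺ (a ∷ as) = ∈-concat⁺′ (∈-map⁺ (a ∷_) as∈) (∈-map⁺ _ (∈-applyUpTo⁺ (λ i → i) (s≤s (m≤m+n a (sum as)))))
  where
  as∈ : as ∈ comps (length as) (a + sum as ∸ a)
  as∈ = subst (λ m → as ∈ comps (length as) m) (sym (m+n∸m≡n a (sum as))) (∈-comps⁺ as)

comps-unique : ∀ t m → Unique (comps t m)
comps-unique zero    zero    = [] ∷ []
comps-unique zero    (suc m) = []
comps-unique (suc t) m       =
  Unique-concatMap (Unique.applyUpTo⁺₁ (λ i → i) (suc m) (λ i<j _ → <⇒≢ i<j))
                   (λ a → Unique.map⁺ ∷-injectiveʳ (comps-unique t (m ∸ a))) head-determined
  where
  head-determined : ∀ {a b as} → as ∈ map (a ∷_) (comps t (m ∸ a)) → as ∈ map (b ∷_) (comps t (m ∸ b)) → a ≡ b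
  head-determined as∈a as∈b with ∈-map⁻ _ as∈a | ∈-map⁻ _ as∈b
  ... | _ , _ , refl | _ , _ , refl = refl

∈-comps-upTo⁻ : ∀ {m t as} → t ∈ applyUpTo suc m → as ∈ comps t (m ∸ t) → sum as + length as ≡ m
∈-comps-upTo⁻ {m} {t} t∈ as∈ with ∈-applyUpTo⁻ suc t∈ | ∈-comps⁻ t (m ∸ t) as∈
... | _ , i<m , refl | length≡ , sum≡ = trans (cong₂ _+_ sum≡ length≡) (m∸n+n≡m i<m)

∈-comps-upTo⁺ : ∀ {m i} as → length as ≡ suc i → sum as + length as ≡ m →
                suc i ∈ applyUpTo suc m × as ∈ comps (suc i) (m ∸ suc i)
∈-comps-upTo⁺ {i = i} as length≡ refl rewrite length≡ =
  ∈-applyUpTo⁺ suc (m≤n+m (suc i) (sum as)) ,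
  subst₂ (λ t s → as ∈ comps t s) length≡ (sym (m+n∸n≡m (sum as) (suc i))) (∈-comps⁺ as)

termWords : ℕ → List ℕ → List Word
termWords k as with unsnoc as
... | nothing         = []
... | just (ini , at) = [ replicate k x ++ blocks (at ∷ ini) ]

term-fromWords : ∀ k as → term k as ≡ fromWords (termWords k as)
term-fromWords k as with unsnoc as
... | nothing         = refl
... | just (ini , at) = cong word (begin
  z (at + k + 1) ++ concatMap (λ a → z (a + 1)) ini  ≡⟨ concatMap-z-blocks (at + k ∷ ini) ⟩
  blocks (at + k ∷ ini)                              ≡⟨ blocks-+ at k ini ⟩
  replicate k x ++ blocks (at ∷ ini)                 ∎)

termWords-∷ʳ : ∀ k ini at → termWords k (ini ∷ʳ at) ≡ [ replicate k x ++ blocks (at ∷ ini) ]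
termWords-∷ʳ k ini at rewrite unsnoc-∷ʳ ini at = refl

∈-termWords⁻ : ∀ k {as w} → w ∈ termWords k as →
               ∃₂ λ ini at → as ≡ ini ∷ʳ at × w ≡ replicate k x ++ blocks (at ∷ ini)
∈-termWords⁻ k {as} w∈ with initLast as | w∈
... | ini ∷ʳ′ at | here w≡ = ini , at , refl , w≡

termWords-unique : ∀ k as → Unique (termWords k as)
termWords-unique k as with unsnoc as
... | nothing = []
... | just _  = [] ∷ []

termWords-injective : ∀ k {as bs w} → w ∈ termWords k as → w ∈ termWords k bs → as ≡ bs
termWords-injective k w∈as w∈bs with ∈-termWords⁻ k w∈as | ∈-termWords⁻ k w∈bs
... | ini , at , refl , refl | ini′ , at′ , refl , w≡
  with blocks-injective {at ∷ ini} {at′ ∷ ini′} (++-cancelˡ (replicate k x) _ _ w≡)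
...   | refl = refl

rhsWords : ℕ → ℕ → List Word
rhsWords k n = concatMap (λ t → concatMap (termWords k) (comps t (n + 1 ∸ t))) (applyUpTo suc (n + 1))

RHS-fromWords : ∀ k n → RHS k n ≡ fromWords (rhsWords k n)
RHS-fromWords k n =
  trans (concatMap-cong (λ t → trans (concatMap-cong (term-fromWords k) (comps t (n + 1 ∸ t)))
                                     (concatMap-fromWords (termWords k) (comps t (n + 1 ∸ t))))
                        (applyUpTo suc (n + 1)))
        (concatMap-fromWords _ (applyUpTo suc (n + 1)))

∈-rhsWords⁻ : ∀ k n {w} → w ∈ rhsWords k n →
              ∃₂ λ ini at → length (blocks (at ∷ ini)) ≡ n + 1 × w ≡ replicate k x ++ blocks (at ∷ ini)
∈-rhsWords⁻ k n w∈ with find (∈-concatMap⁻ _ {xs = applyUpTo suc (n + 1)} w∈)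
... | t , t∈ , w∈t with find (∈-concatMap⁻ (termWords k) {xs = comps t (n + 1 ∸ t)} w∈t)
...   | as , as∈ , w∈as with ∈-termWords⁻ k w∈as
...     | ini , at , refl , w≡ =
  ini , at , trans (length-blocks-rotate at ini) (∈-comps-upTo⁻ t∈ as∈) , w≡

∈-rhsWords⁺ : ∀ k n ini at → length (blocks (at ∷ ini)) ≡ n + 1 →
              replicate k x ++ blocks (at ∷ ini) ∈ rhsWords k n
∈-rhsWords⁺ k n ini at length≡ with ∈-comps-upTo⁺ (ini ∷ʳ at) (sym (↭-length (∷↭∷ʳ at ini)))
                                                 (trans (sym (length-blocks-rotate at ini)) length≡)
... | t∈ , as∈ = ∈-concat⁺′ (∈-concat⁺′ w∈ (∈-map⁺ (termWords k) as∈)) (∈-map⁺ _ t∈)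
  where
  w∈ : replicate k x ++ blocks (at ∷ ini) ∈ termWords k (ini ∷ʳ at)
  w∈ = subst (replicate k x ++ blocks (at ∷ ini) ∈_) (sym (termWords-∷ʳ k ini at)) (here refl)

rhsWords-unique : ∀ k n → Unique (rhsWords k n)
rhsWords-unique k n =
  Unique-concatMap (Unique.applyUpTo⁺₁ suc (n + 1) (λ i<j _ → <⇒≢ i<j ∘ suc-injective))
    (λ t → Unique-concatMap (comps-unique t (n + 1 ∸ t)) (termWords-unique k) (termWords-injective k))
    length-determined
  where
  length-determined : ∀ {t t′ w} → w ∈ concatMap (termWords k) (comps t (n + 1 ∸ t)) →
                      w ∈ concatMap (termWords k) (comps t′ (n + 1 ∸ t′)) → t ≡ t′
  length-determined {t} {t′} w∈t w∈t′
    with find (∈-concatMap⁻ (termWords k) {xs = comps t (n + 1 ∸ t)} w∈t)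
       | find (∈-concatMap⁻ (termWords k) {xs = comps t′ (n + 1 ∸ t′)} w∈t′)
  ... | as , as∈ , w∈as | bs , bs∈ , w∈bs with termWords-injective k w∈as w∈bs
  ...   | refl = trans (sym (proj₁ (∈-comps⁻ t _ as∈))) (proj₁ (∈-comps⁻ t′ _ bs∈))

lhsWords⊆rhsWords : ∀ k n → lhsWords k n ⊆ rhsWords k n
lhsWords⊆rhsWords k n w∈ with ∈-map⁻ _ w∈
... | u , u∈ , refl with ∷ʳy-blocks u
...   | b , bs , u∷ʳy≡ =
  subst (_∈ rhsWords k n) (cong (replicate k x ++_) (sym u∷ʳy≡)) (∈-rhsWords⁺ k n bs b length≡)
  where
  length≡ : length (blocks (b ∷ bs)) ≡ n + 1
  length≡ = trans (cong length (sym u∷ʳy≡))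
                  (trans (length-++ u) (cong (_+ 1) (∈-σWords-replicate-y⁻ n u∈)))

rhsWords⊆lhsWords : ∀ k n → rhsWords k n ⊆ lhsWords k n
rhsWords⊆lhsWords k n w∈ with ∈-rhsWords⁻ k n w∈
... | ini , at , length≡ , refl with blocks-∷ʳy at ini
...   | u , blocks≡ =
  subst₂ (λ v m → replicate k x ++ v ∈ lhsWords k m) (sym blocks≡) length-u
         (∈-map⁺ _ (∈-σWords-replicate-y⁺ u))
  where
  length-u : length u ≡ n
  length-u = +-cancelʳ-≡ 1 _ _ (trans (sym (length-++ u)) (trans (cong length (sym blocks≡)) length≡))

lemma2p2 : (k n : ℕ) → 1 ≤ k → 1 ≤ n →
    S (word (z (k + 1) ++ z1^ n)) ≈P RHS k n
lemma2p2 k n _ _ rewrite S-lhs k n | RHS-fromWords k n =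
  fromWords-≈P (lhsWords-unique k n) (rhsWords-unique k n) (lhsWords⊆rhsWords k n) (rhsWords⊆lhsWords k n)
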